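{- Let $S$ be a $3$-connected isotropic system with at least $5$ vertices. Every internal vertex of a tight path in $H(S)$ is essential in $S$.
   Context: $K=\{0,\alpha,\beta,\gamma\}$ is the $2$-dimensional $\mathrm{GF}(2)$-space with bilinear form $\langle x,y\rangle=1$ iff $0\ne x\ne y\ne0$; $K^V$ is the space of functions $V\to K$ with $\langle\mathbf a,\mathbf b\rangle=\sum_v\langle\mathbf a(v),\mathbf b(v)\rangle$; $\mathrm{supp}(\mathbf a)=\{v:\mathbf a(v)\ne0\}$; $p_X$ is restriction to $X$. An isotropic system $S=(V,L)$ is a finite set $V$ with a subspace $L\subseteq K^V$ such that $\langle\mathbf a,\mathbf b\rangle=0$ for all $\mathbf a,\mathbf b\in L$ and $\dim L=|V|$. Elementary minor: $S|^v_x=(V\setminus\{v\},\{p_{V\setminus\{v\}}(\mathbf a):\mathbf a\in L,\mathbf a(v)\in\{0,x\}\})$ for $x\in K\setminus\{0\}$. Connectivity: $c_S(X)=|X|-\dim\{p_X(\mathbf a):\mathbf a\in L,\mathrm{supp}(\mathbf a)\subseteq X\}$; $(X,Y)$ is a $k$-separation if $\min\{|X|,|Y|\}\ge k$ and $c_S(X)<k$; $S$ is $3$-connected if it has no $1$- or $2$-separation. A vertex $v$ is non-essential if at least two of $S|^v_\alpha,S|^v_\beta,S|^v_\gamma$ are $3$-connected, and essential otherwise. A triangle is a vector of $L$ with support of size $3$; $H(S)$ is the $3$-uniform hypergraph on $V$ whose edges are supports of triangles. A tight path of length $k\ge1$ is a partial hypergraph $P$ (vertex and edge sets contained in those of $H(S)$)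 with an ordering $v_0,\dots,v_{k+1}$ of $V(P)$ such that $E(P)=\{\{v_{i-1},v_i,v_{i+1}\}:1\le i\le k\}$; an internal vertex of $P$ is a vertex incident with at least two edges of $P$. -}

module Defs where

open import Data.Bool using (Bool; true; false; _∧_; _∨_; not; _xor_; if_then_else_; T)
open import Data.Nat using (ℕ; zero; suc; _+_; _∸_; _^_; _≤_; _<_)
open import Data.Nat.Logarithm using (⌊log₂_⌋)
open import Data.Fin using (Fin; zero; suc; punchIn; inject₁)
open import Data.Fin.Properties using (_≟_)
open import Data.List using (List; []; _∷_; map; concatMap; foldr; length; allFin)
open import Data.Vec.Functional using (Vector) renaming (_∷_ to _◂_)
open import Data.Product using (Σ; _×_; _,_; ∃)
open import Data.Sum using (_⊎_)
open import Relation.Nullary using (¬_; does)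
open import Relation.Binary.PropositionalEquality using (_≡_; _≢_)
open import Function using (_⇔_)
open import Function.Definitions using (Injective)

data K : Set where
  𝟘 α β γ : K

-- addition (K ≅ GF(2)², with γ = α + β)
_+K_ : K → K → K
𝟘 +K y = y
x +K 𝟘 = x
α +K α = 𝟘
α +K β = γ
α +K γ = β
β +K α = γ
β +K β = 𝟘
β +K γ = α
γ +K α = β
γ +K β = α
γ +K γ = 𝟘

_==K_ : K → K → Bool
𝟘 ==K 𝟘 = true
α ==K α = true
β ==K β = true
γ ==K γ = true
_ ==K _ = false

isZero : K → Bool
isZero x = x ==K 𝟘

⟨_,_⟩K : K → K → Bool
⟨ x , y ⟩K = not (isZero x) ∧ not (isZero y) ∧ not (x ==K y)

KV : ℕ → Set
KV n = Fin n → K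

𝟎 : ∀ {n} → KV n
𝟎 _ = 𝟘

_+V_ : ∀ {n} → KV n → KV n → KV n
(a +V b) i = a i +K b i

⟨_,_⟩ : ∀ {n} → KV n → KV n → Bool
⟨_,_⟩ {n} a b = foldr (λ i r → ⟨ a i , b i ⟩K xor r) false (allFin n)

_==V_ : ∀ {n} → KV n → KV n → Bool
_==V_ {n} a b = foldr (λ i r → (a i ==K b i) ∧ r) true (allFin n)

allK : List K
allK = 𝟘 ∷ α ∷ β ∷ γ ∷ []

allVecs : (n : ℕ) → List (KV n)
allVecs zero = (λ ()) ∷ []
allVecs (suc n) = concatMap (λ x → map (λ f → x ◂ f) (allVecs n)) allK

SubsetKV : ℕ → Set
SubsetKV n = KV n → Bool

countᵇ : ∀ {A : Set} → (A → Bool) → List A → ℕ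
countᵇ P [] = 0
countᵇ P (x ∷ xs) = if P x then suc (countᵇ P xs) else countᵇ P xs

card : ∀ {n} → SubsetKV n → ℕ
card {n} L = countᵇ L (allVecs n)

-- dimension of a GF(2)-subspace W: |W| = 2^dim W, i.e. dim W = log₂ |W|
dim : ∀ {n} → SubsetKV n → ℕ
dim L = ⌊log₂ card L ⌋

IsSubspace : ∀ {n} → SubsetKV n → Set
IsSubspace L = T (L 𝟎) × (∀ a b → T (L a) → T (L b) → T (L (a +V b)))

IsIsotropicSystem : (n : ℕ) → SubsetKV n → Set
IsIsotropicSystem n L =
  IsSubspace L
  × (∀ a b → T (L a) → T (L b) → ⟨ a , b ⟩ ≡ false)
  × dim L ≡ n

VSubset : ℕ → Set
VSubset n = Fin n → Bool

size : ∀ {n} → VSubset n → ℕ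
size {n} X = countᵇ X (allFin n)

compl : ∀ {n} → VSubset n → VSubset n
compl X i = not (X i)

suppInᵇ : ∀ {n} → KV n → VSubset n → Bool
suppInᵇ {n} a X = foldr (λ i r → (X i ∨ isZero (a i)) ∧ r) true (allFin n)

-- p_X(a), represented as a vector of K^V that is zero outside X
-- (this identifies K^X with the vectors of K^V vanishing outside X)
restrict : ∀ {n} → VSubset n → KV n → KV n
restrict X a i = if X i then a i else 𝟘

anyᵇ : ∀ {A : Set} → (A → Bool) → List A → Bool
anyᵇ P = foldr (λ x r → P x ∨ r) false

restrictedSpace : ∀ {n} → SubsetKV n → VSubset n → SubsetKV n
restrictedSpace {n} L X w =
  suppInᵇ w X ∧
  anyᵇ (λ a → L a ∧ suppInᵇ a X ∧ (restrict X a ==V w)) (allVecs n)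

conn : ∀ {n} → SubsetKV n → VSubset n → ℕ
conn L X = size X ∸ dim (restrictedSpace L X)

IsSeparation : ∀ {n} → SubsetKV n → ℕ → VSubset n → Set
IsSeparation L k X = k ≤ size X × k ≤ size (compl X) × conn L X < k

ThreeConnected : ∀ {n} → SubsetKV n → Set
ThreeConnected L = ∀ X → ¬ IsSeparation L 1 X × ¬ IsSeparation L 2 X

-- Elementary minors S|^v_x, with V∖{v} identified with Fin m via punchIn v

minor : ∀ {m} → SubsetKV (suc m) → Fin (suc m) → K → SubsetKV m
minor {m} L v x w =
  anyᵇ (λ a → L a ∧ (isZero (a v) ∨ (a v ==K x))
                  ∧ ((λ i → a (punchIn v i)) ==V w))
       (allVecs (suc m))

NonEssential : ∀ {n} → SubsetKV n → Fin n → Set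
NonEssential {suc m} L v =
    (ThreeConnected (minor L v α) × ThreeConnected (minor L v β))
  ⊎ (ThreeConnected (minor L v α) × ThreeConnected (minor L v γ))
  ⊎ (ThreeConnected (minor L v β) × ThreeConnected (minor L v γ))

Essential : ∀ {n} → SubsetKV n → Fin n → Set
Essential L v = ¬ NonEssential L v

IsEdge : ∀ {n} → SubsetKV n → Fin n → Fin n → Fin n → Set
IsEdge L u v w =
  u ≢ v × v ≢ w × u ≢ w ×
  Σ (KV _) λ a → T (L a) ×
    (∀ i → (a i ≢ 𝟘) ⇔ ((i ≡ u) ⊎ (i ≡ v) ⊎ (i ≡ w)))

-- Edge number i+1 of the paper is indexed here by i : Fin k.
edgeVerts : ∀ {n k} → (Fin (suc (suc k)) → Fin n) → Fin k → Fin n × Fin n × Fin n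
edgeVerts p i = p (inject₁ (inject₁ i)) , p (suc (inject₁ i)) , p (suc (suc i))

record TightPath {n : ℕ} (L : SubsetKV n) (k : ℕ) : Set where
  field
    1≤k   : 1 ≤ k
    vert  : Fin (suc (suc k)) → Fin n
    inj   : Injective _≡_ _≡_ vert
    edges : ∀ i → let (a , b , c) = edgeVerts vert i in IsEdge L a b c

InEdge : ∀ {n k} → (Fin (suc (suc k)) → Fin n) → Fin k → Fin n → Set
InEdge p i v = let (a , b , c) = edgeVerts p i in (v ≡ a) ⊎ (v ≡ b) ⊎ (v ≡ c)

IsInternal : ∀ {n k} {L : SubsetKV n} → TightPath L k → Fin n → Set
IsInternal {k = k} P v =
  Σ (Fin k) λ i → Σ (Fin k) λ j → i ≢ j × InEdge (TightPath.vert P) i v × InEdge (TightPath.vert P) j v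

{-# OPTIONS --safe #-}
-- An internal vertex v of a tight path lies in two consecutive edges {u, v, w} and {v, w, u′},
-- the supports of triangles a and b of L. If a v ≠ b v, deleting v from a and from b leaves
-- vectors supported on two vertices in the minors S|^v_(a v) and S|^v_(b v), so neither of
-- these is 3-connected. If a v = b v, orthogonality of a and b forces a w = b w, so a + b ∈ L
-- is supported on {u, u′} and S itself would have a 2-separation.
--
-- L is only a Boolean predicate on functions, so members of L have to be replaced by their
-- normal forms in allVecs. That L contains these is maximality of Lagrangian subspaces: an
-- isotropic set of vectors in K^n has at most 2^n elements.
module Submission where

open import Defs
open import Algebra.Bundles using (CommutativeRing)
open import Data.Bool using (Bool; true; false; _∧_; _∨_; not; _xor_; if_then_else_; T)
open import Data.Bool.Properties as Boolᵖ
  using (T?; T-∧; T-∨; xor-identityʳ; xor-∧-commutativeRing)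
open import Data.Empty using (⊥; ⊥-elim)
open import Data.Fin using (Fin; zero; suc; toℕ; fromℕ<; inject₁; punchIn; punchOut)
open import Data.Fin.Properties
  using (_≟_; suc-injective; toℕ<n; toℕ-injective; toℕ-fromℕ<; fromℕ<-toℕ; toℕ-inject₁;
         punchInᵢ≢i; punchIn-injective; punchIn-punchOut; punchOut-injective)
open import Data.List using ([]; _∷_; _++_; foldr; map; concatMap; length; allFin)
open import Data.List.Membership.Propositional using (_∈_)
open import Data.List.Membership.Propositional.Properties using (∈-concatMap⁺; ∈-map⁺)
open import Data.List.Properties using (foldr-cong; foldr-map; map-tabulate; length-tabulate)
import Data.List.Relation.Unary.All as All
open import Data.List.Relation.Unary.Any as Any using (here; there)
open import Data.Nat using (ℕ; zero; suc; _+_; _∸_; _^_; _≤_; _<_; _<?_; z≤n; s≤s; ⌊_/2⌋; ⌈_/2⌉)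
open import Data.Nat.ListAction using (sum)
open import Data.Nat.Logarithm using (⌊log₂_⌋; ⌊log₂⌋-mono-≤; ⌊log₂⌊n/2⌋⌋≡⌊log₂n⌋∸1)
open import Data.Nat.Properties
  using (+-comm; +-assoc; +-identityʳ; +-suc; +-mono-≤; +-cancelˡ-≤; ≤-refl; ≤-trans; ≤-antisym;
         <-irrefl; <-trans; <-cmp; n≤1+n; n<1+n; m≤n+m; m≤n⇒m≤1+n; m≤n⇒m<n∨m≡n; m∸n≤m;
         ⌊n/2⌋≤⌈n/2⌉; ⌊n/2⌋+⌈n/2⌉≡n; module ≤-Reasoning)
open import Data.Product using (Σ; Σ-syntax; _×_; _,_; proj₁; proj₂)
open import Data.Sum using (_⊎_; inj₁; inj₂; [_,_]′; map₂; swap)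
open import Data.Vec.Functional using (tail) renaming (_∷_ to _◂_)
open import Function using (_∘_; _⇔_; Equivalence; mk⇔)
import Function.Properties.Equivalence as ⇔
open import Relation.Binary.Definitions using (DecidableEquality; tri<; tri≈; tri>)
open import Relation.Binary.PropositionalEquality
  using (_≡_; _≢_; _≗_; refl; sym; trans; cong; cong₂; subst; ≢-sym; module ≡-Reasoning)
open import Relation.Nullary using (Dec; yes; no; ¬_; does; contradiction)
open import Relation.Nullary.Decidable using (map′; from-yes; ¬?; _→-dec_; decidable-stable)
open import Relation.Unary using (Decidable)

open import Algebra.Properties.CommutativeSemigroup
  (CommutativeRing.+-commutativeSemigroup xor-∧-commutativeRing) using (interchange)

infix 4 _≟K_
_≟K_ : DecidableEquality K
𝟘 ≟K 𝟘 = yes refl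
𝟘 ≟K α = no λ ()
𝟘 ≟K β = no λ ()
𝟘 ≟K γ = no λ ()
α ≟K 𝟘 = no λ ()
α ≟K α = yes refl
α ≟K β = no λ ()
α ≟K γ = no λ ()
β ≟K 𝟘 = no λ ()
β ≟K α = no λ ()
β ≟K β = yes refl
β ≟K γ = no λ ()
γ ≟K 𝟘 = no λ ()
γ ≟K α = no λ ()
γ ≟K β = no λ ()
γ ≟K γ = yes refl

∈-allK : ∀ x → x ∈ allK
∈-allK 𝟘 = here refl
∈-allK α = there (here refl)
∈-allK β = there (there (here refl))
∈-allK γ = there (there (there (here refl)))

∀K? : {P : K → Set} → Decidable P → Dec (∀ x → P x)
∀K? P? = map′ (λ ps x → All.lookup ps (∈-allK x)) (λ ps → All.tabulate (λ {x} _ → ps x))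
              (All.all? P? allK)

==K-refl : ∀ x → T (x ==K x)
==K-refl = from-yes (∀K? λ x → T? (x ==K x))

==K-sound : ∀ x y → T (x ==K y) → x ≡ y
==K-sound = from-yes (∀K? λ x → ∀K? λ y → T? (x ==K y) →-dec x ≟K y)

+K-identityʳ : ∀ x → x +K 𝟘 ≡ x
+K-identityʳ = from-yes (∀K? λ x → x +K 𝟘 ≟K x)

+K-self : ∀ x → x +K x ≡ 𝟘
+K-self = from-yes (∀K? λ x → x +K x ≟K 𝟘)

+K-involutive : ∀ x t → (x +K t) +K t ≡ x
+K-involutive = from-yes (∀K? λ x → ∀K? λ t → (x +K t) +K t ≟K x)

ipK-self : ∀ x → ⟨ x , x ⟩K ≡ false
ipK-self = from-yes (∀K? λ x → ⟨ x , x ⟩K Boolᵖ.≟ false)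

ipK-zeroʳ : ∀ x → ⟨ x , 𝟘 ⟩K ≡ false
ipK-zeroʳ = from-yes (∀K? λ x → ⟨ x , 𝟘 ⟩K Boolᵖ.≟ false)

ipK-sym : ∀ x y → ⟨ x , y ⟩K ≡ ⟨ y , x ⟩K
ipK-sym = from-yes (∀K? λ x → ∀K? λ y → ⟨ x , y ⟩K Boolᵖ.≟ ⟨ y , x ⟩K)

ipK-addˡ : ∀ x y z → ⟨ x +K y , z ⟩K ≡ ⟨ x , z ⟩K xor ⟨ y , z ⟩K
ipK-addˡ = from-yes (∀K? λ x → ∀K? λ y → ∀K? λ z →
  ⟨ x +K y , z ⟩K Boolᵖ.≟ (⟨ x , z ⟩K xor ⟨ y , z ⟩K))

ipK-orthogonal⇒≡ : ∀ x y → ⟨ x , y ⟩K ≡ false → x ≢ 𝟘 → y ≢ 𝟘 → x ≡ y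
ipK-orthogonal⇒≡ = from-yes (∀K? λ x → ∀K? λ y →
  (⟨ x , y ⟩K Boolᵖ.≟ false) →-dec ¬? (x ≟K 𝟘) →-dec ¬? (y ≟K 𝟘) →-dec x ≟K y)

allFin-suc : ∀ n → allFin (suc n) ≡ zero ∷ map suc (allFin n)
allFin-suc n = cong (zero ∷_) (sym (map-tabulate (λ i → i) suc))

foldr-allFin-suc : ∀ {B : Set} {n} (f : Fin (suc n) → B → B) e →
  foldr f e (allFin (suc n)) ≡ f zero (foldr (f ∘ suc) e (allFin n))
foldr-allFin-suc {n = n} f e =
  trans (cong (foldr f e) (allFin-suc n)) (cong (f zero) (foldr-map f suc e (allFin n)))

⟨,⟩-suc : ∀ {n} (a b : KV (suc n)) → ⟨ a , b ⟩ ≡ ⟨ a zero , b zero ⟩K xor ⟨ tail a , tail b ⟩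
⟨,⟩-suc a b = foldr-allFin-suc (λ i r → ⟨ a i , b i ⟩K xor r) false

⟨,⟩-cong : ∀ {n} {a a′ b b′ : KV n} → a ≗ a′ → b ≗ b′ → ⟨ a , b ⟩ ≡ ⟨ a′ , b′ ⟩
⟨,⟩-cong {n} a≗a′ b≗b′ =
  foldr-cong (λ i r → cong (_xor r) (cong₂ ⟨_,_⟩K (a≗a′ i) (b≗b′ i))) refl (allFin n)

⟨,⟩-sym : ∀ {n} (a b : KV n) → ⟨ a , b ⟩ ≡ ⟨ b , a ⟩
⟨,⟩-sym {n} a b = foldr-cong (λ i r → cong (_xor r) (ipK-sym (a i) (b i))) refl (allFin n)

⟨,⟩-addˡ : ∀ {n} (a b c : KV n) → ⟨ a +V b , c ⟩ ≡ ⟨ a , c ⟩ xor ⟨ b , c ⟩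
⟨,⟩-addˡ {zero} a b c = refl
⟨,⟩-addˡ {suc n} a b c = begin
  ⟨ a +V b , c ⟩
    ≡⟨ ⟨,⟩-suc (a +V b) c ⟩
  ⟨ a zero +K b zero , c zero ⟩K xor ⟨ tail a +V tail b , tail c ⟩
    ≡⟨ cong₂ _xor_ (ipK-addˡ (a zero) (b zero) (c zero)) (⟨,⟩-addˡ (tail a) (tail b) (tail c)) ⟩
  (⟨ a zero , c zero ⟩K xor ⟨ b zero , c zero ⟩K) xor (⟨ tail a , tail c ⟩ xor ⟨ tail b , tail c ⟩)
    ≡⟨ interchange ⟨ a zero , c zero ⟩K ⟨ b zero , c zero ⟩K
                   ⟨ tail a , tail c ⟩ ⟨ tail b , tail c ⟩ ⟩
  (⟨ a zero , c zero ⟩K xor ⟨ tail a , tail c ⟩) xor (⟨ b zero , c zero ⟩K xor ⟨ tail b , tail c ⟩)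
    ≡⟨ sym (cong₂ _xor_ (⟨,⟩-suc a c) (⟨,⟩-suc b c)) ⟩
  ⟨ a , c ⟩ xor ⟨ b , c ⟩ ∎
  where open ≡-Reasoning

⟨,⟩-addʳ : ∀ {n} (a b c : KV n) → ⟨ a , b +V c ⟩ ≡ ⟨ a , b ⟩ xor ⟨ a , c ⟩
⟨,⟩-addʳ a b c = trans (⟨,⟩-sym a (b +V c))
  (trans (⟨,⟩-addˡ b c a) (cong₂ _xor_ (⟨,⟩-sym b a) (⟨,⟩-sym c a)))

⟨+,+⟩-orthogonal : ∀ {n} (a b c d : KV n) → ⟨ a , c ⟩ ≡ false → ⟨ a , d ⟩ ≡ false →
  ⟨ b , c ⟩ ≡ false → ⟨ b , d ⟩ ≡ false → ⟨ a +V b , c +V d ⟩ ≡ false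
⟨+,+⟩-orthogonal a b c d ac ad bc bd
  rewrite ⟨,⟩-addˡ a b (c +V d) | ⟨,⟩-addʳ a c d | ⟨,⟩-addʳ b c d | ac | ad | bc | bd = refl

⟨,⟩-null : ∀ {n} (a b : KV n) → (∀ i → ⟨ a i , b i ⟩K ≡ false) → ⟨ a , b ⟩ ≡ false
⟨,⟩-null {zero} _ _ _ = refl
⟨,⟩-null {suc n} a b ab≡0
  rewrite ⟨,⟩-suc a b | ab≡0 zero = ⟨,⟩-null (tail a) (tail b) (λ i → ab≡0 (suc i))

⟨,⟩-single : ∀ {n} (a b : KV n) w → (∀ i → i ≢ w → ⟨ a i , b i ⟩K ≡ false) →
  ⟨ a , b ⟩ ≡ ⟨ a w , b w ⟩K
⟨,⟩-single a b zero ab≡0 rewrite ⟨,⟩-suc a b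
  | ⟨,⟩-null (tail a) (tail b) (λ i → ab≡0 (suc i) λ ()) = xor-identityʳ _
⟨,⟩-single a b (suc w) ab≡0 rewrite ⟨,⟩-suc a b | ab≡0 zero (λ ()) =
  ⟨,⟩-single (tail a) (tail b) w (λ i i≢w → ab≡0 (suc i) (λ si≡sw → i≢w (suc-injective si≡sw)))

foldr∧-intro : ∀ {n} (g : Fin n → Bool) → (∀ i → T (g i)) →
  T (foldr (λ i r → g i ∧ r) true (allFin n))
foldr∧-intro {zero}  g _ = _
foldr∧-intro {suc n} g all-g rewrite foldr-allFin-suc (λ i r → g i ∧ r) true =
  Equivalence.from T-∧ (all-g zero , foldr∧-intro (g ∘ suc) (λ i → all-g (suc i)))

foldr∧-elim : ∀ {n} (g : Fin n → Bool) → T (foldr (λ i r → g i ∧ r) true (allFin n)) → ∀ i → T (g i)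
foldr∧-elim {suc n} g t i rewrite foldr-allFin-suc (λ i r → g i ∧ r) true
  with Equivalence.to (T-∧ {g zero}) t | i
... | g0 , _    | zero  = g0
... | _  , rest | suc i = foldr∧-elim (g ∘ suc) rest i

==V-intro : ∀ {n} {a b : KV n} → a ≗ b → T (a ==V b)
==V-intro {a = a} a≗b = foldr∧-intro _ λ i → subst (λ y → T (a i ==K y)) (a≗b i) (==K-refl (a i))

==V-sound : ∀ {n} {a b : KV n} → T (a ==V b) → a ≗ b
==V-sound {a = a} {b} t i = ==K-sound (a i) (b i) (foldr∧-elim _ t i)

module _ {A : Set} where

  countᵇ-++ : ∀ (P : A → Bool) xs ys → countᵇ P (xs ++ ys) ≡ countᵇ P xs + countᵇ P ys
  countᵇ-++ P [] ys = refl
  countᵇ-++ P (x ∷ xs) ys with P x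
  ... | true  = cong suc (countᵇ-++ P xs ys)
  ... | false = countᵇ-++ P xs ys

  countᵇ-map : ∀ {B : Set} (P : A → Bool) (f : B → A) xs → countᵇ P (map f xs) ≡ countᵇ (P ∘ f) xs
  countᵇ-map P f [] = refl
  countᵇ-map P f (x ∷ xs) rewrite countᵇ-map P f xs = refl

  countᵇ-concatMap-map : ∀ {B C : Set} (P : A → Bool) (h : B → C → A) xs ys →
    countᵇ P (concatMap (λ x → map (h x) ys) xs) ≡ sum (map (λ x → countᵇ (P ∘ h x) ys) xs)
  countᵇ-concatMap-map P h [] ys = refl
  countᵇ-concatMap-map P h (x ∷ xs) ys = trans (countᵇ-++ P (map (h x) ys) _)
    (cong₂ _+_ (countᵇ-map P (h x) ys) (countᵇ-concatMap-map P h xs ys))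

  countᵇ-false : ∀ xs → countᵇ (λ (_ : A) → false) xs ≡ 0
  countᵇ-false []       = refl
  countᵇ-false (_ ∷ xs) = countᵇ-false xs

  countᵇ-cong : ∀ {P Q : A → Bool} → (∀ x → P x ≡ Q x) → ∀ xs → countᵇ P xs ≡ countᵇ Q xs
  countᵇ-cong P≗Q [] = refl
  countᵇ-cong P≗Q (x ∷ xs) rewrite P≗Q x | countᵇ-cong P≗Q xs = refl

  countᵇ-∨ : ∀ (P Q : A → Bool) → (∀ x → T (P x) → T (Q x) → ⊥) →
    ∀ xs → countᵇ (λ x → P x ∨ Q x) xs ≡ countᵇ P xs + countᵇ Q xs
  countᵇ-∨ P Q disjoint [] = refl
  countᵇ-∨ P Q disjoint (x ∷ xs) with P x | Q x | disjoint x
  ... | true  | true  | PQx = ⊥-elim (PQx _ _)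
  ... | true  | false | _   = cong suc (countᵇ-∨ P Q disjoint xs)
  ... | false | true  | _   = trans (cong suc (countᵇ-∨ P Q disjoint xs)) (sym (+-suc _ _))
  ... | false | false | _   = countᵇ-∨ P Q disjoint xs

  countᵇ-not : ∀ (P : A → Bool) xs → countᵇ P xs + countᵇ (not ∘ P) xs ≡ length xs
  countᵇ-not P [] = refl
  countᵇ-not P (x ∷ xs) with P x
  ... | true  = cong suc (countᵇ-not P xs)
  ... | false = trans (+-suc _ _) (cong suc (countᵇ-not P xs))

  countᵇ-zero-or-witness : ∀ (P : A → Bool) xs → countᵇ P xs ≡ 0 ⊎ Σ A (T ∘ P)
  countᵇ-zero-or-witness P [] = inj₁ refl
  countᵇ-zero-or-witness P (x ∷ xs) with P x in Px
  ... | true  = inj₂ (x , subst T (sym Px) _)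
  ... | false = countᵇ-zero-or-witness P xs

  countᵇ-mono : ∀ {P Q : A → Bool} → (∀ x → T (P x) → T (Q x)) → ∀ xs → countᵇ P xs ≤ countᵇ Q xs
  countᵇ-mono P⊆Q [] = z≤n
  countᵇ-mono {P} {Q} P⊆Q (x ∷ xs) with P x | Q x | P⊆Q x
  ... | true  | true  | _   = s≤s (countᵇ-mono P⊆Q xs)
  ... | true  | false | P⊆Qx = ⊥-elim (P⊆Qx _)
  ... | false | true  | _   = ≤-trans (countᵇ-mono P⊆Q xs) (n≤1+n _)
  ... | false | false | _   = countᵇ-mono P⊆Q xs

  countᵇ-< : ∀ {P Q : A → Bool} → (∀ x → T (P x) → T (Q x)) →
    ∀ {x xs} → x ∈ xs → T (Q x) → ¬ T (P x) → countᵇ P xs < countᵇ Q xs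
  countᵇ-< {P} {Q} P⊆Q {xs = y ∷ ys} (here refl) Qx ¬Px with P y | Q y
  ... | true  | _     = ⊥-elim (¬Px _)
  ... | false | true  = s≤s (countᵇ-mono P⊆Q ys)
  ... | false | false = ⊥-elim Qx
  countᵇ-< {P} {Q} P⊆Q {xs = y ∷ ys} (there x∈ys) Qx ¬Px with P y | Q y | P⊆Q y
  ... | true  | true  | _   = s≤s (countᵇ-< P⊆Q x∈ys Qx ¬Px)
  ... | true  | false | P⊆Qy = ⊥-elim (P⊆Qy _)
  ... | false | true  | _   = ≤-trans (countᵇ-< P⊆Q x∈ys Qx ¬Px) (n≤1+n _)
  ... | false | false | _   = countᵇ-< P⊆Q x∈ys Qx ¬Px

  countᵇ-≥1 : ∀ (P : A → Bool) {x xs} → x ∈ xs → T (P x) → 1 ≤ countᵇ P xs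
  countᵇ-≥1 P {xs = y ∷ ys} (here refl) Px with P y
  ... | true  = s≤s z≤n
  countᵇ-≥1 P {xs = y ∷ ys} (there x∈ys) Px with P y
  ... | true  = s≤s z≤n
  ... | false = countᵇ-≥1 P x∈ys Px

  countᵇ-≥2 : ∀ (P : A → Bool) {x y xs} → x ∈ xs → y ∈ xs → x ≢ y → T (P x) → T (P y) →
    2 ≤ countᵇ P xs
  countᵇ-≥2 P (here refl) (here refl) x≢y _ _ = ⊥-elim (x≢y refl)
  countᵇ-≥2 P {xs = z ∷ zs} (here refl) (there y∈zs) _ Px Py with P z
  ... | true = s≤s (countᵇ-≥1 P y∈zs Py)
  countᵇ-≥2 P {xs = z ∷ zs} (there x∈zs) (here refl) _ Px Py with P z
  ... | true = s≤s (countᵇ-≥1 P x∈zs Px)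
  countᵇ-≥2 P {xs = z ∷ zs} (there x∈zs) (there y∈zs) x≢y Px Py with P z
  ... | true  = s≤s (countᵇ-≥1 P x∈zs Px)
  ... | false = countᵇ-≥2 P x∈zs y∈zs x≢y Px Py

anyᵇ-intro : ∀ {A : Set} (P : A → Bool) {x xs} → x ∈ xs → T (P x) → T (anyᵇ P xs)
anyᵇ-intro P {xs = y ∷ _} (here refl) Px = Equivalence.from (T-∨ {P y}) (inj₁ Px)
anyᵇ-intro P {xs = y ∷ _} (there x∈xs) Px =
  Equivalence.from (T-∨ {P y}) (inj₂ (anyᵇ-intro P x∈xs Px))

#_ : ∀ {n} → (KV n → Bool) → ℕ
#_ {n} P = countᵇ P (allVecs n)

sumK : (K → ℕ) → ℕ
sumK g = g 𝟘 + g α + (g β + g γ)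

sumK-cong : ∀ {g h : K → ℕ} → g ≗ h → sumK g ≡ sumK h
sumK-cong g≗h = cong₂ _+_ (cong₂ _+_ (g≗h 𝟘) (g≗h α)) (cong₂ _+_ (g≗h β) (g≗h γ))

sumK-translate : ∀ t (g : K → ℕ) → sumK (λ c → g (c +K t)) ≡ sumK g
sumK-translate 𝟘 g = refl
sumK-translate α g = cong₂ _+_ (+-comm (g α) (g 𝟘)) (+-comm (g γ) (g β))
sumK-translate β g = +-comm (g β + g γ) (g 𝟘 + g α)
sumK-translate γ g = trans (+-comm (g γ + g β) (g α + g 𝟘))
  (cong₂ _+_ (+-comm (g α) (g 𝟘)) (+-comm (g γ) (g β)))

#-by-head : ∀ {n} (P : KV (suc n) → Bool) → # P ≡ sumK (λ c → # (λ f → P (c ◂ f)))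
#-by-head {n} P =
  trans (countᵇ-concatMap-map P _◂_ allK (allVecs n)) (regroup (A 𝟘) (A α) (A β) (A γ))
  where
  A : K → ℕ
  A c = # (λ f → P (c ◂ f))
  regroup : ∀ a b c d → a + (b + (c + (d + 0))) ≡ a + b + (c + d)
  regroup a b c d rewrite +-identityʳ d = sym (+-assoc a b (c + d))

-- Functions on Fin 0 are not definitionally equal, so the normal form of a
-- vector must end in exactly the one listed by allVecs 0.
[]ᴷ : KV 0
[]ᴷ with allVecs 0
... | a ∷ _ = a
... | []    = λ ()

rep : ∀ {n} → KV n → KV n
rep {zero}  _ = []ᴷ
rep {suc n} a = a zero ◂ rep (tail a)

rep-≗ : ∀ {n} (a : KV n) → rep a ≗ a
rep-≗ a zero    = refl
rep-≗ a (suc i) = rep-≗ (tail a) i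

rep-cong : ∀ {n} {a b : KV n} → a ≗ b → rep a ≡ rep b
rep-cong {zero}  _   = refl
rep-cong {suc n} a≗b = cong₂ _◂_ (a≗b zero) (rep-cong (λ i → a≗b (suc i)))

rep∈allVecs : ∀ {n} (a : KV n) → rep a ∈ allVecs n
rep∈allVecs {zero}  a = here refl
rep∈allVecs {suc n} a = ∈-concatMap⁺ (λ c → map (c ◂_) (allVecs n))
  (Any.map (λ { refl → ∈-map⁺ (a zero ◂_) (rep∈allVecs (tail a)) }) (∈-allK (a zero)))

#∘rep : ∀ {n} (P : KV n → Bool) → # (P ∘ rep) ≡ # P
#∘rep {zero}  P = refl
#∘rep {suc n} P = trans (#-by-head (P ∘ rep))
  (trans (sumK-cong (λ c → #∘rep (λ f → P (c ◂ f)))) (sym (#-by-head P)))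

-- Isotropic sets of vectors have at most 2^n elements

Isotropic : ∀ {n} → (KV n → Bool) → Set
Isotropic P = ∀ a b → T (P a) → T (P b) → ⟨ a , b ⟩ ≡ false

Extensional : ∀ {n} → (KV n → Bool) → Set
Extensional P = ∀ {a b} → a ≗ b → P a ≡ P b

xor≡false⇒≡ : ∀ x y → x xor y ≡ false → x ≡ y
xor≡false⇒≡ false false _ = refl
xor≡false⇒≡ true  true  _ = refl

tail-orthogonal : ∀ {n} c d (f g : KV n) → ⟨ c , d ⟩K ≡ false → ⟨ c ◂ f , d ◂ g ⟩ ≡ false →
  ⟨ f , g ⟩ ≡ false
tail-orthogonal c d f g cd≡0 ⟨⟩≡0 =
  trans (cong (_xor ⟨ f , g ⟩) (sym cd≡0)) (trans (sym (⟨,⟩-suc (c ◂ f) (d ◂ g))) ⟨⟩≡0)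

◂-cong : ∀ {n} c {f g : KV n} → f ≗ g → (c ◂ f) ≗ (c ◂ g)
◂-cong c f≗g zero    = refl
◂-cong c f≗g (suc i) = f≗g i

module _ {n} {P : KV (suc n) → Bool} where

  head-isotropic : Isotropic P → ∀ c → Isotropic (λ f → P (c ◂ f))
  head-isotropic iso c f g Pf Pg = tail-orthogonal c c f g (ipK-self c) (iso _ _ Pf Pg)

  head-extensional : Extensional P → ∀ c → Extensional (λ f → P (c ◂ f))
  head-extensional ext c f≗g = ext (◂-cong c f≗g)

  two-heads-isotropic : Isotropic P → ∀ {c d} → ⟨ c , d ⟩K ≡ false →
    Isotropic (λ f → P (c ◂ f) ∨ P (d ◂ f))
  two-heads-isotropic iso {c} {d} cd≡0 f g Pf Pg
    with Equivalence.to (T-∨ {P (c ◂ f)}) Pf | Equivalence.to (T-∨ {P (c ◂ g)}) Pg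
  ... | inj₁ Pcf | inj₁ Pcg = head-isotropic iso c f g Pcf Pcg
  ... | inj₁ Pcf | inj₂ Pdg = tail-orthogonal c d f g cd≡0 (iso _ _ Pcf Pdg)
  ... | inj₂ Pdf | inj₁ Pcg = tail-orthogonal d c f g (trans (ipK-sym d c) cd≡0) (iso _ _ Pdf Pcg)
  ... | inj₂ Pdf | inj₂ Pdg = head-isotropic iso d f g Pdf Pdg

  two-heads-extensional : Extensional P → ∀ c d → Extensional (λ f → P (c ◂ f) ∨ P (d ◂ f))
  two-heads-extensional ext c d f≗g = cong₂ _∨_ (ext (◂-cong c f≗g)) (ext (◂-cong d f≗g))

  -- c ◂ f and d ◂ f cannot both be orthogonal to w.
  two-heads-count : Isotropic P → ∀ {c d w} → T (P w) → ⟨ c , w zero ⟩K ≢ ⟨ d , w zero ⟩K →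
    # (λ f → P (c ◂ f)) + # (λ f → P (d ◂ f)) ≡ # (λ f → P (c ◂ f) ∨ P (d ◂ f))
  two-heads-count iso {c} {d} {w} Pw cw≢dw = sym (countᵇ-∨ _ _ disjoint (allVecs n))
    where
    disjoint : ∀ f → T (P (c ◂ f)) → T (P (d ◂ f)) → ⊥
    disjoint f Pcf Pdf = cw≢dw (trans (≡tail Pcf) (sym (≡tail Pdf)))
      where
      ≡tail : ∀ {e} → T (P (e ◂ f)) → ⟨ e , w zero ⟩K ≡ ⟨ f , tail w ⟩
      ≡tail {e} Pef = xor≡false⇒≡ _ _ (trans (sym (⟨,⟩-suc (e ◂ f) w)) (iso _ _ Pef Pw))

  two-heads-empty-or-witness : ∀ c d {b} → ⟨ α , c ⟩K ≡ b → ⟨ α , d ⟩K ≡ b →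
    # (λ f → P (c ◂ f)) + # (λ f → P (d ◂ f)) ≡ 0
    ⊎ Σ (KV (suc n)) λ w → T (P w) × ⟨ α , w zero ⟩K ≡ b
  two-heads-empty-or-witness c d αc αd
    with countᵇ-zero-or-witness (λ f → P (c ◂ f)) (allVecs n)
       | countᵇ-zero-or-witness (λ f → P (d ◂ f)) (allVecs n)
  ... | inj₂ (f , Pcf) | _              = inj₂ (c ◂ f , Pcf , αc)
  ... | _              | inj₂ (f , Pdf) = inj₂ (d ◂ f , Pdf , αd)
  ... | inj₁ c≡0       | inj₁ d≡0       = inj₁ (cong₂ _+_ c≡0 d≡0)

module _ {n} {P : KV n → Bool} where

  +V-extensional : Extensional P → ∀ t → Extensional (λ x → P (x +V t))
  +V-extensional ext t a≗b = ext (λ i → cong (_+K t i) (a≗b i))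

  +V-isotropic : Isotropic P → ∀ {t} → T (P t) → Isotropic (λ x → P (x +V t))
  +V-isotropic iso {t} Pt a b Pa Pb = trans
    (⟨,⟩-cong (λ i → sym (+K-involutive (a i) (t i))) (λ i → sym (+K-involutive (b i) (t i))))
    (⟨+,+⟩-orthogonal (a +V t) t (b +V t) t
      (iso _ _ Pa Pb) (iso _ _ Pa Pt) (iso _ _ Pt Pb) (iso _ _ Pt Pt))

◂-+V : ∀ {n} c (f : KV n) t → (c ◂ f) +V t ≗ (c +K t zero) ◂ (f +V tail t)
◂-+V c f t zero    = refl
◂-+V c f t (suc i) = refl

#-translate : ∀ {n} {P : KV n → Bool} → Extensional P → ∀ t → # (λ x → P (x +V t)) ≡ # P

#-translate-head : ∀ {n} {P : KV (suc n) → Bool} → Extensional P → ∀ t c →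
  # (λ f → P ((c ◂ f) +V t)) ≡ # (λ f → P ((c +K t zero) ◂ f))
#-translate-head {P = P} ext t c =
  trans (countᵇ-cong (λ f → ext (◂-+V c f t)) (allVecs _))
        (#-translate (head-extensional ext (c +K t zero)) (tail t))

#-translate {zero} ext t = cong (λ b → if b then 1 else 0) (ext {[]ᴷ +V t} {[]ᴷ} λ ())
#-translate {suc n} {P} ext t = begin
  # (λ x → P (x +V t))                        ≡⟨ #-by-head (λ x → P (x +V t)) ⟩
  sumK (λ c → # (λ f → P ((c ◂ f) +V t)))      ≡⟨ sumK-cong (#-translate-head ext t) ⟩
  sumK (λ c → # (λ f → P ((c +K t zero) ◂ f))) ≡⟨ sumK-translate (t zero) A ⟩
  sumK (λ c → # (λ f → P (c ◂ f)))            ≡⟨ sym (#-by-head P) ⟩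
  # P                                         ∎
  where
  open ≡-Reasoning
  A : K → ℕ
  A c = # (λ f → P (c ◂ f))

-- ⟨ α , x ⟩K is false on the line {𝟘, α} and true on its coset {β, γ}.
line-separates : ∀ x → ⟨ α , x ⟩K ≡ true → ⟨ 𝟘 , x ⟩K ≢ ⟨ α , x ⟩K
line-separates x αx e = contradiction (trans e αx) λ ()

coset-shift : ∀ c → ⟨ α , c ⟩K ≡ true → ∀ (g : K → ℕ) → g (𝟘 +K c) + g (α +K c) ≡ g β + g γ
coset-shift β _ g = refl
coset-shift γ _ g = +-comm (g γ) (g β)

module _ {n} (bound : ∀ (Q : KV n → Bool) → Isotropic Q → Extensional Q → # Q ≤ 2 ^ n) where

  two-heads-bound : ∀ {P : KV (suc n) → Bool} → Isotropic P → Extensional P →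
    ∀ {c d w} → ⟨ c , d ⟩K ≡ false → T (P w) → ⟨ c , w zero ⟩K ≢ ⟨ d , w zero ⟩K →
    # (λ f → P (c ◂ f)) + # (λ f → P (d ◂ f)) ≤ 2 ^ n
  two-heads-bound iso ext {c} {d} cd≡0 Pw cw≢dw =
    subst (_≤ 2 ^ n) (sym (two-heads-count iso Pw cw≢dw))
      (bound _ (two-heads-isotropic iso cd≡0) (two-heads-extensional ext c d))

  -- Translating by w moves the coset {β, γ} onto the line, where u + w separates the heads.
  coset-bound : ∀ {P : KV (suc n) → Bool} → Isotropic P → Extensional P →
    ∀ {w u} → T (P w) → ⟨ α , w zero ⟩K ≡ true → T (P u) → ⟨ α , u zero ⟩K ≡ false →
    # (λ f → P (β ◂ f)) + # (λ f → P (γ ◂ f)) ≤ 2 ^ n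
  coset-bound {P} iso ext {w} {u} Pw αw Pu αu = begin
    A β + A γ                         ≡⟨ sym (coset-shift (w zero) αw A) ⟩
    A (𝟘 +K w zero) + A (α +K w zero) ≡⟨ sym (cong₂ _+_ (#-translate-head ext w 𝟘)
                                                        (#-translate-head ext w α)) ⟩
    # (λ f → P ((𝟘 ◂ f) +V w)) + # (λ f → P ((α ◂ f) +V w))
      ≤⟨ two-heads-bound (+V-isotropic iso Pw) (+V-extensional ext w) {w = u +V w} refl Pu+w+w
                         (line-separates (u zero +K w zero) αu+w) ⟩
    2 ^ n                             ∎
    where
    open ≤-Reasoning
    A : K → ℕ
    A c = # (λ f → P (c ◂ f))
    Pu+w+w : T (P ((u +V w) +V w))
    Pu+w+w = subst T (sym (ext λ i → +K-involutive (u i) (w i))) Pu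
    αu+w : ⟨ α , u zero +K w zero ⟩K ≡ true
    αu+w = trans (ipK-sym α (u zero +K w zero)) (trans (ipK-addˡ (u zero) (w zero) α)
      (cong₂ _xor_ (trans (ipK-sym (u zero) α) αu) (trans (ipK-sym (w zero) α) αw)))

-- Split by the head coordinate into the line {𝟘, α} and its coset {β, γ}; each half has at
-- most 2^n members as soon as the other half is nonempty.
isotropic-bound-ext : ∀ {n} (P : KV n → Bool) → Isotropic P → Extensional P → # P ≤ 2 ^ n
isotropic-bound-ext {zero} P _ _ with P []ᴷ
... | true  = ≤-refl
... | false = z≤n
isotropic-bound-ext {suc n} P iso ext = begin
  # P                       ≡⟨ #-by-head P ⟩
  A 𝟘 + A α + (A β + A γ)   ≤⟨ halves ⟩
  2 ^ n + 2 ^ n             ≡⟨ cong (2 ^ n +_) (sym (+-identityʳ (2 ^ n))) ⟩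
  2 ^ suc n                 ∎
  where
  open ≤-Reasoning
  bound = isotropic-bound-ext {n}
  A : K → ℕ
  A c = # (λ f → P (c ◂ f))
  head-bound : ∀ c → A c ≤ 2 ^ n
  head-bound c = bound _ (head-isotropic iso c) (head-extensional ext c)
  halves : A 𝟘 + A α + (A β + A γ) ≤ 2 ^ n + 2 ^ n
  halves with two-heads-empty-or-witness {P = P} β γ refl refl
             | two-heads-empty-or-witness {P = P} 𝟘 α refl refl
  ... | inj₁ coset≡0 | _ rewrite coset≡0 =
    subst (_≤ 2 ^ n + 2 ^ n) (sym (+-identityʳ _)) (+-mono-≤ (head-bound 𝟘) (head-bound α))
  ... | inj₂ _ | inj₁ line≡0 rewrite line≡0 = +-mono-≤ (head-bound β) (head-bound γ)
  ... | inj₂ (w , Pw , αw) | inj₂ (u , Pu , αu) = +-mono-≤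
    (two-heads-bound bound iso ext refl Pw (line-separates (w zero) αw))
    (coset-bound bound iso ext Pw αw Pu αu)

isotropic-bound : ∀ {n} (P : KV n → Bool) → Isotropic P → # P ≤ 2 ^ n
isotropic-bound {n} P iso = subst (_≤ 2 ^ n) (#∘rep P)
  (isotropic-bound-ext (P ∘ rep) iso∘rep (λ a≗b → cong P (rep-cong a≗b)))
  where
  iso∘rep : Isotropic (P ∘ rep)
  iso∘rep a b Pa Pb =
    trans (⟨,⟩-cong (λ i → sym (rep-≗ a i)) (λ i → sym (rep-≗ b i))) (iso _ _ Pa Pb)

⌊log₂⌋≡⇒2^≤ : ∀ n c → ⌊log₂ c ⌋ ≡ suc n → 2 ^ suc n ≤ c
⌊log₂⌋≡⇒2^≤ zero    (suc (suc c)) _ = s≤s (s≤s z≤n)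
⌊log₂⌋≡⇒2^≤ (suc n) c@(suc (suc _)) log≡ = begin
  2 ^ suc (suc n)          ≡⟨ cong (2 ^ suc n +_) (+-identityʳ _) ⟩
  2 ^ suc n + 2 ^ suc n    ≤⟨ +-mono-≤ half (≤-trans half (⌊n/2⌋≤⌈n/2⌉ c)) ⟩
  ⌊ c /2⌋ + ⌈ c /2⌉        ≡⟨ ⌊n/2⌋+⌈n/2⌉≡n c ⟩
  c                        ∎
  where
  open ≤-Reasoning
  half : 2 ^ suc n ≤ ⌊ c /2⌋
  half = ⌊log₂⌋≡⇒2^≤ n ⌊ c /2⌋ (trans (⌊log₂⌊n/2⌋⌋≡⌊log₂n⌋∸1 c) (cong (_∸ 1) log≡))

-- L is a maximal isotropic set: otherwise L together with rep a would beat the bound.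
rep-closed : ∀ {m} {L : SubsetKV (suc m)} → IsIsotropicSystem (suc m) L →
  ∀ {a} → T (L a) → T (L (rep a))
rep-closed {m} {L} (_ , orth , dim≡) {a} La with L (rep a) in L[rep-a]
... | true  = _
... | false = contradiction (begin-strict
  2 ^ suc m  ≤⟨ ⌊log₂⌋≡⇒2^≤ m (# L) dim≡ ⟩
  # L        <⟨ countᵇ-< (λ e Le → Equivalence.from T-∨ (inj₁ Le)) (rep∈allVecs a)
                  (Equivalence.from (T-∨ {L (rep a)}) (inj₂ (==V-intro (rep-≗ a))))
                  (λ t → subst T L[rep-a] t) ⟩
  # Q        ≤⟨ isotropic-bound Q Q-isotropic ⟩
  2 ^ suc m  ∎) (<-irrefl refl)
  where
  open ≤-Reasoning
  Q : SubsetKV (suc m)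
  Q e = L e ∨ (e ==V a)
  member : ∀ e → T (Q e) → Σ (KV (suc m)) λ f → e ≗ f × T (L f)
  member e Qe with Equivalence.to (T-∨ {L e}) Qe
  ... | inj₁ Le  = e , (λ _ → refl) , Le
  ... | inj₂ e≈a = a , ==V-sound e≈a , La
  Q-isotropic : Isotropic Q
  Q-isotropic e e′ Qe Qe′ with member e Qe | member e′ Qe′
  ... | f , e≗f , Lf | f′ , e′≗f′ , Lf′ = trans (⟨,⟩-cong e≗f e′≗f′) (orth f f′ Lf Lf′)

-- Separations from vectors of small support

countᵇ-allFin-≟ : ∀ {m} (p : Fin m) → countᵇ (λ i → does (i ≟ p)) (allFin m) ≡ 1
countᵇ-allFin-≟ {suc m} p = trans (cong (countᵇ (λ i → does (i ≟ p))) (allFin-suc m)) (split p)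
  where
  split : ∀ p → countᵇ (λ i → does (i ≟ p)) (zero ∷ map suc (allFin m)) ≡ 1
  split zero    = cong suc (trans (countᵇ-map (λ i → does (i ≟ zero)) suc (allFin m))
                                  (countᵇ-false (allFin m)))
  split (suc p) = trans (countᵇ-map (λ i → does (i ≟ suc p)) suc (allFin m)) (countᵇ-allFin-≟ p)

pairSet : ∀ {m} → Fin m → Fin m → VSubset m
pairSet p q i = does (i ≟ p) ∨ does (i ≟ q)

size-pairSet : ∀ {m} {p q : Fin m} → p ≢ q → size (pairSet p q) ≡ 2
size-pairSet {m} {p} {q} p≢q = trans (countᵇ-∨ _ _ disjoint (allFin m))
  (cong₂ _+_ (countᵇ-allFin-≟ p) (countᵇ-allFin-≟ q))
  where
  disjoint : ∀ i → T (does (i ≟ p)) → T (does (i ≟ q)) → ⊥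
  disjoint i _ _ with i ≟ p | i ≟ q
  ... | yes refl | yes refl = p≢q refl

pairSet-false : ∀ {m} {p q i : Fin m} → pairSet p q i ≡ false → i ≢ p × i ≢ q
pairSet-false {p = p} {q} {i} _ with i ≟ p | i ≟ q
... | no i≢p | no i≢q = i≢p , i≢q

restrictedSpace-intro : ∀ {m} {M : SubsetKV m} {X : VSubset m} {w} → w ∈ allVecs m → T (M w) →
  (∀ i → X i ≡ false → w i ≡ 𝟘) → T (restrictedSpace M X w)
restrictedSpace-intro {M = M} {X} {w} w∈ Mw vanishes = Equivalence.from T-∧ (supported ,
  anyᵇ-intro _ w∈
    (Equivalence.from T-∧ (Mw , Equivalence.from T-∧ (supported , ==V-intro restricted))))
  where
  supported : T (suppInᵇ w X)
  supported = foldr∧-intro _ λ i → case i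
    where
    case : ∀ i → T (X i ∨ isZero (w i))
    case i with X i in Xi
    ... | true  = _
    ... | false rewrite vanishes i Xi = _
  restricted : restrict X w ≗ w
  restricted i with X i in Xi
  ... | true  = refl
  ... | false = sym (vanishes i Xi)

short-vector-separates : ∀ {m} {M : SubsetKV m} {p q : Fin m} → 4 ≤ m → p ≢ q →
  T (M (rep 𝟎)) → (c : KV m) → T (M (rep c)) → (∀ i → i ≢ p → i ≢ q → c i ≡ 𝟘) → c p ≢ 𝟘 →
  IsSeparation M 2 (pairSet p q)
short-vector-separates {m} {M} {p} {q} 4≤m p≢q M0 c Mc c-vanishes cp≢𝟘 =
  subst (2 ≤_) (sym size≡2) ≤-refl , 2≤size-compl , conn<2
  where
  X = pairSet p q
  R = restrictedSpace M X
  size≡2 : size X ≡ 2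
  size≡2 = size-pairSet p≢q
  2≤size-compl : 2 ≤ size (compl X)
  2≤size-compl = +-cancelˡ-≤ 2 2 _ (subst (4 ≤_) covers 4≤m)
    where
    covers : m ≡ 2 + size (compl X)
    covers = trans (sym (trans (countᵇ-not X (allFin m)) (length-tabulate (λ i → i))))
                   (cong (_+ size (compl X)) size≡2)
  rep-vanishes : ∀ {a : KV m} → (∀ i → i ≢ p → i ≢ q → a i ≡ 𝟘) → ∀ i → X i ≡ false → rep a i ≡ 𝟘
  rep-vanishes {a} a-vanishes i Xi = let i≢p , i≢q = pairSet-false Xi in
    trans (rep-≗ a i) (a-vanishes i i≢p i≢q)
  R0 : T (R (rep 𝟎))
  R0 = restrictedSpace-intro {M = M} (rep∈allVecs 𝟎) M0 (rep-vanishes λ _ _ _ → refl)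
  Rc : T (R (rep c))
  Rc = restrictedSpace-intro {M = M} (rep∈allVecs c) Mc (rep-vanishes c-vanishes)
  rep0≢repc : rep 𝟎 ≢ rep c
  rep0≢repc eq = cp≢𝟘 (trans (sym (rep-≗ c p)) (trans (cong (λ a → a p) (sym eq)) (rep-≗ 𝟎 p)))
  1≤dim : 1 ≤ dim R
  1≤dim = ⌊log₂⌋-mono-≤ (countᵇ-≥2 R (rep∈allVecs 𝟎) (rep∈allVecs c) rep0≢repc R0 Rc)
  conn<2 : conn M X < 2
  conn<2 rewrite size≡2 with dim R | 1≤dim
  ... | suc d | _ = s≤s (m∸n≤m 1 d)

-- Triangles and minors

SupportIs : ∀ {n} → KV n → Fin n → Fin n → Fin n → Set
SupportIs a x y z = ∀ i → (a i ≢ 𝟘) ⇔ ((i ≡ x) ⊎ (i ≡ y) ⊎ (i ≡ z))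

support-nonzero : ∀ {n} {a : KV n} {x y z} → SupportIs a x y z →
  ∀ {i} → (i ≡ x) ⊎ (i ≡ y) ⊎ (i ≡ z) → a i ≢ 𝟘
support-nonzero supp {i} = Equivalence.from (supp i)

support-vanishes : ∀ {n} {a : KV n} {x y z} → SupportIs a x y z →
  ∀ i → i ≢ x → i ≢ y → i ≢ z → a i ≡ 𝟘
support-vanishes {a = a} supp i i≢x i≢y i≢z = decidable-stable (a i ≟K 𝟘) λ ai≢𝟘 →
  [ i≢x , [ i≢y , i≢z ]′ ]′ (Equivalence.to (supp i) ai≢𝟘)

minor-intro : ∀ {m} {L : SubsetKV (suc m)} {v x w} (e : KV (suc m)) → T (L (rep e)) →
  e v ≡ 𝟘 ⊎ e v ≡ x → (∀ i → e (punchIn v i) ≡ w i) → T (minor L v x w)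
minor-intro {L = L} {v} {x} e Le ev punched = anyᵇ-intro _ (rep∈allVecs e)
  (Equivalence.from T-∧ (Le , Equivalence.from T-∧ (head-allowed ,
    ==V-intro λ i → trans (rep-≗ e (punchIn v i)) (punched i))))
  where
  head-allowed : T (isZero (rep e v) ∨ (rep e v ==K x))
  head-allowed rewrite rep-≗ e v = allowed ev
    where
    allowed : ∀ {y} → y ≡ 𝟘 ⊎ y ≡ x → T (isZero y ∨ (y ==K x))
    allowed (inj₁ refl) = _
    allowed (inj₂ refl) = Equivalence.from (T-∨ {isZero x}) (inj₂ (==K-refl x))

-- Deleting v from a triangle through v leaves a vector supported on two vertices.
triangle-minor-not-3-connected : ∀ {m} {L : SubsetKV (suc m)} → IsIsotropicSystem (suc m) L →
  4 ≤ m → ∀ {v s t} → v ≢ s → v ≢ t → s ≢ t → ∀ {a} → T (L a) → a s ≢ 𝟘 →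
  (∀ i → i ≢ v → i ≢ s → i ≢ t → a i ≡ 𝟘) → ¬ ThreeConnected (minor L v (a v))
triangle-minor-not-3-connected {L = L} iso 4≤m {v} {s} {t} v≢s v≢t s≢t {a} La as≢𝟘 a-vanishes
  3conn =
  proj₂ (3conn (pairSet p q))
    (short-vector-separates {M = minor L v (a v)} 4≤m p≢q M0 (λ i → a (punchIn v i)) Ma
      (λ i i≢p i≢q → a-vanishes _ (punchInᵢ≢i v i) (punchIn≢ v≢s i≢p) (punchIn≢ v≢t i≢q))
      (subst (λ j → a j ≢ 𝟘) (sym (punchIn-punchOut v≢s)) as≢𝟘))
  where
  p = punchOut v≢s
  q = punchOut v≢t
  p≢q : p ≢ q
  p≢q eq = s≢t (punchOut-injective v≢s v≢t eq)
  punchIn≢ : ∀ {j} (v≢j : v ≢ j) {i} → i ≢ punchOut v≢j → punchIn v i ≢ j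
  punchIn≢ v≢j {i} i≢pj eq = i≢pj (punchIn-injective v i _ (trans eq (sym (punchIn-punchOut v≢j))))
  M0 : T (minor L v (a v) (rep 𝟎))
  M0 = minor-intro {L = L} {v} 𝟎 (rep-closed iso (proj₁ (proj₁ iso))) (inj₁ refl)
    (λ i → sym (rep-≗ 𝟎 i))
  Ma : T (minor L v (a v) (rep (λ i → a (punchIn v i))))
  Ma = minor-intro {L = L} {v} a (rep-closed iso La) (inj₂ refl)
    (λ i → sym (rep-≗ (λ i → a (punchIn v i)) i))

all-but-one-minor : ∀ {m} {L : SubsetKV (suc m)} {v} → NonEssential L v →
  Σ K λ z → ∀ x → x ≢ 𝟘 → x ≢ z → ThreeConnected (minor L v x)
all-but-one-minor (inj₁ (Tα , Tβ)) = γ , λ where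
  𝟘 x≢𝟘 _ → ⊥-elim (x≢𝟘 refl) ; α _ _ → Tα ; β _ _ → Tβ ; γ _ x≢γ → ⊥-elim (x≢γ refl)
all-but-one-minor (inj₂ (inj₁ (Tα , Tγ))) = β , λ where
  𝟘 x≢𝟘 _ → ⊥-elim (x≢𝟘 refl) ; α _ _ → Tα ; β _ x≢β → ⊥-elim (x≢β refl) ; γ _ _ → Tγ
all-but-one-minor (inj₂ (inj₂ (Tβ , Tγ))) = α , λ where
  𝟘 x≢𝟘 _ → ⊥-elim (x≢𝟘 refl) ; α _ x≢α → ⊥-elim (x≢α refl) ; β _ _ → Tβ ; γ _ _ → Tγ

two-minors⇒essential : ∀ {m} {L : SubsetKV (suc m)} {v x y} → x ≢ 𝟘 → y ≢ 𝟘 → x ≢ y →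
  ¬ ThreeConnected (minor L v x) → ¬ ThreeConnected (minor L v y) → Essential L v
two-minors⇒essential {L = L} {v} x≢𝟘 y≢𝟘 x≢y ¬3x ¬3y nonEssential
  with all-but-one-minor {L = L} {v} nonEssential
... | z , others = x≢y (trans (≡z x≢𝟘 ¬3x) (sym (≡z y≢𝟘 ¬3y)))
  where
  ≡z : ∀ {x} → x ≢ 𝟘 → ¬ ThreeConnected (minor L v x) → x ≡ z
  ≡z {x} x≢𝟘 ¬3x = decidable-stable (x ≟K z) λ x≢z → ¬3x (others x x≢𝟘 x≢z)

-- Orthogonality of a and b forces them to agree at w as well, so a + b lives on {u, u′}.
agreeing-triangles-separate : ∀ {m} {L : SubsetKV (suc m)} → IsIsotropicSystem (suc m) L →
  4 ≤ suc m → ∀ {u v w u′} → u ≢ v → u ≢ w → u ≢ u′ →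
  ∀ {a b} → T (L a) → SupportIs a u v w → T (L b) → SupportIs b v w u′ → a v ≡ b v →
  IsSeparation L 2 (pairSet u u′)
agreeing-triangles-separate {L = L} iso@((L0 , closed) , orth , _) 4≤n {u} {v} {w} {u′} u≢v u≢w u≢u′
  {a} {b} La supp-a Lb supp-b av≡bv =
  short-vector-separates {M = L} 4≤n u≢u′ (rep-closed iso L0) (a +V b)
    (rep-closed iso (closed a b La Lb)) sum-vanishes sum-at-u
  where
  bu≡𝟘 : b u ≡ 𝟘
  bu≡𝟘 = support-vanishes supp-b u u≢v u≢w u≢u′
  coordinates-orthogonal : ∀ i → i ≢ w → ⟨ a i , b i ⟩K ≡ false
  coordinates-orthogonal i i≢w with i ≟ v | i ≟ u
  ... | yes refl | _        = trans (cong (⟨ a v ,_⟩K) (sym av≡bv)) (ipK-self (a v))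
  ... | no _     | yes refl = trans (cong (⟨ a u ,_⟩K) bu≡𝟘) (ipK-zeroʳ (a u))
  ... | no i≢v   | no i≢u   = cong (⟨_, b i ⟩K) (support-vanishes supp-a i i≢u i≢v i≢w)
  aw≡bw : a w ≡ b w
  aw≡bw = ipK-orthogonal⇒≡ (a w) (b w)
    (trans (sym (⟨,⟩-single a b w coordinates-orthogonal)) (orth a b La Lb))
    (support-nonzero supp-a (inj₂ (inj₂ refl))) (support-nonzero supp-b (inj₂ (inj₁ refl)))
  sum-vanishes : ∀ i → i ≢ u → i ≢ u′ → a i +K b i ≡ 𝟘
  sum-vanishes i i≢u i≢u′ with i ≟ v | i ≟ w
  ... | yes refl | _        = trans (cong (a v +K_) (sym av≡bv)) (+K-self (a v))
  ... | no _     | yes refl = trans (cong (a w +K_) (sym aw≡bw)) (+K-self (a w))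
  ... | no i≢v   | no i≢w
    rewrite support-vanishes supp-a i i≢u i≢v i≢w | support-vanishes supp-b i i≢v i≢w i≢u′ = refl
  sum-at-u : a u +K b u ≢ 𝟘
  sum-at-u rewrite bu≡𝟘 | +K-identityʳ (a u) = support-nonzero supp-a (inj₁ refl)

shared-pair-essential : ∀ {m} {L : SubsetKV (suc m)} → IsIsotropicSystem (suc m) L →
  ThreeConnected L → 4 ≤ m → ∀ {u v w u′} → u ≢ u′ → IsEdge L u v w → IsEdge L v w u′ →
  Essential L v
shared-pair-essential {L = L} iso 3conn 4≤m {v = v} u≢u′ (u≢v , v≢w , u≢w , a , La , supp-a)
  (_ , w≢u′ , v≢u′ , b , Lb , supp-b) with a v ≟K b v
... | yes av≡bv = ⊥-elim (proj₂ (3conn _)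
  (agreeing-triangles-separate iso (m≤n⇒m≤1+n 4≤m) u≢v u≢w u≢u′ La supp-a Lb supp-b av≡bv))
... | no av≢bv = two-minors⇒essential {L = L}
  (support-nonzero supp-a (inj₂ (inj₁ refl))) (support-nonzero supp-b (inj₁ refl)) av≢bv
  (triangle-minor-not-3-connected {L = L} iso 4≤m (≢-sym u≢v) v≢w u≢w La
    (support-nonzero supp-a (inj₁ refl))
    λ i i≢v i≢u i≢w → support-vanishes supp-a i i≢u i≢v i≢w)
  (triangle-minor-not-3-connected {L = L} iso 4≤m v≢u′ v≢w (≢-sym w≢u′) Lb
    (support-nonzero supp-b (inj₂ (inj₂ refl)))
    λ i i≢v i≢u′ i≢w → support-vanishes supp-b i i≢v i≢w i≢u′)

-- Tight paths

module _ {n} {L : SubsetKV n} where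

  IsEdge-swap₂₃ : ∀ {u v w} → IsEdge L u v w → IsEdge L u w v
  IsEdge-swap₂₃ (u≢v , v≢w , u≢w , a , La , supp) =
    u≢w , ≢-sym v≢w , u≢v , a , La , λ i → ⇔.trans (supp i) (mk⇔ (map₂ swap) (map₂ swap))

  IsEdge-swap₁₂ : ∀ {u v w} → IsEdge L u v w → IsEdge L v u w
  IsEdge-swap₁₂ (u≢v , v≢w , u≢w , a , La , supp) =
    ≢-sym u≢v , u≢w , v≢w , a , La , λ i → ⇔.trans (supp i) (mk⇔ swap₁₂ swap₁₂)
    where
    swap₁₂ : ∀ {A B C : Set} → A ⊎ B ⊎ C → B ⊎ A ⊎ C
    swap₁₂ = [ inj₂ ∘ inj₁ , [ inj₁ , inj₂ ∘ inj₂ ]′ ]′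

module _ {n k} {L : SubsetKV n} (P : TightPath L k) where
  open TightPath P

  -- Positions beyond the end of the path get a junk vertex.
  at : ℕ → Fin n
  at l with l <? 2 + k
  ... | yes l<2+k = vert (fromℕ< l<2+k)
  ... | no _      = vert zero

  at-fromℕ< : ∀ {l} (l<2+k : l < 2 + k) → at l ≡ vert (fromℕ< l<2+k)
  at-fromℕ< {l} l<2+k with l <? 2 + k
  ... | yes _     = refl
  ... | no l≮2+k = contradiction l<2+k l≮2+k

  at-toℕ : ∀ r {l} → toℕ r ≡ l → at l ≡ vert r
  at-toℕ r refl = trans (at-fromℕ< (toℕ<n r)) (cong vert (fromℕ<-toℕ r (toℕ<n r)))

  at-injective : ∀ {l l′} → l < 2 + k → l′ < 2 + k → at l ≡ at l′ → l ≡ l′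
  at-injective {l} {l′} l<2+k l′<2+k eq = begin
    l                     ≡⟨ sym (toℕ-fromℕ< l<2+k) ⟩
    toℕ (fromℕ< l<2+k)    ≡⟨ cong toℕ (inj vert-eq) ⟩
    toℕ (fromℕ< l′<2+k)   ≡⟨ toℕ-fromℕ< l′<2+k ⟩
    l′                    ∎
    where
    open ≡-Reasoning
    vert-eq = trans (sym (at-fromℕ< l<2+k)) (trans eq (at-fromℕ< l′<2+k))

  at-edge₁ : ∀ i → at (toℕ i) ≡ vert (inject₁ (inject₁ i))
  at-edge₁ i = at-toℕ (inject₁ (inject₁ i)) (trans (toℕ-inject₁ (inject₁ i)) (toℕ-inject₁ i))

  at-edge₂ : ∀ i → at (1 + toℕ i) ≡ vert (suc (inject₁ i))
  at-edge₂ i = at-toℕ (suc (inject₁ i)) (cong suc (toℕ-inject₁ i))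

  at-edge₃ : ∀ i → at (2 + toℕ i) ≡ vert (suc (suc i))
  at-edge₃ i = at-toℕ (suc (suc i)) refl

  edge-at : ∀ {t} → t < k → IsEdge L (at t) (at (1 + t)) (at (2 + t))
  edge-at t<k = edge-at-index (fromℕ< t<k) (toℕ-fromℕ< t<k)
    where
    edge-at-index : ∀ i {t} → toℕ i ≡ t → IsEdge L (at t) (at (1 + t)) (at (2 + t))
    edge-at-index i refl rewrite at-edge₁ i | at-edge₂ i | at-edge₃ i = edges i

  edge-position : ∀ {i v} → InEdge vert i v → Σ[ r ∈ ℕ ] toℕ i ≤ r × r ≤ 2 + toℕ i × v ≡ at r
  edge-position {i} (inj₁ v≡)        = toℕ i , ≤-refl , m≤n+m _ 2 , trans v≡ (sym (at-edge₁ i))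
  edge-position {i} (inj₂ (inj₁ v≡)) =
    1 + toℕ i , n≤1+n _ , s≤s (n≤1+n _) , trans v≡ (sym (at-edge₂ i))
  edge-position {i} (inj₂ (inj₂ v≡)) = 2 + toℕ i , m≤n+m _ 2 , ≤-refl , trans v≡ (sym (at-edge₃ i))

  shared-position : ∀ {i j v} → toℕ i < toℕ j → InEdge vert i v → InEdge vert j v →
    Σ[ t ∈ ℕ ] 1 + t < k × (v ≡ at (1 + t) ⊎ v ≡ at (2 + t))
  shared-position {i} {j} {v} i<j vi vj with edge-position vi | edge-position vj
  ... | r , _ , r≤2+i , v≡r | r′ , j≤r′ , r′≤2+j , v≡r′ =
    toℕ i , ≤-trans (s≤s i<j) (toℕ<n j) , shared (m≤n⇒m<n∨m≡n r≤2+i)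
    where
    in-path : ∀ {s} (e : Fin k) → s ≤ 2 + toℕ e → s < 2 + k
    in-path e s≤ = ≤-trans (s≤s s≤) (s≤s (s≤s (toℕ<n e)))
    r≡r′ : r ≡ r′
    r≡r′ = at-injective (in-path i r≤2+i) (in-path j r′≤2+j) (trans (sym v≡r) v≡r′)
    shared : r < 2 + toℕ i ⊎ r ≡ 2 + toℕ i → v ≡ at (1 + toℕ i) ⊎ v ≡ at (2 + toℕ i)
    shared (inj₁ (s≤s r≤1+i)) = inj₁ (trans v≡r (cong at
      (≤-antisym r≤1+i (≤-trans i<j (subst (toℕ j ≤_) (sym r≡r′) j≤r′)))))
    shared (inj₂ r≡2+i) = inj₂ (trans v≡r (cong at r≡2+i))

  internal⇒shared-position : ∀ {v} → IsInternal P v →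
    Σ[ t ∈ ℕ ] 1 + t < k × (v ≡ at (1 + t) ⊎ v ≡ at (2 + t))
  internal⇒shared-position (i , j , i≢j , vi , vj) with <-cmp (toℕ i) (toℕ j)
  ... | tri< i<j _ _ = shared-position i<j vi vj
  ... | tri≈ _ i≡j _ = ⊥-elim (i≢j (toℕ-injective i≡j))
  ... | tri> _ _ j<i = shared-position j<i vj vi

  ends-distinct : ∀ {t} → 1 + t < k → at t ≢ at (3 + t)
  ends-distinct 1+t<k eq
    with at-injective (≤-trans (<-trans (n<1+n _) 1+t<k) (m≤n+m _ 2)) (s≤s (s≤s 1+t<k)) eq
  ... | ()

  consecutive-edges : ∀ {v} t → 1 + t < k → v ≡ at (1 + t) ⊎ v ≡ at (2 + t) →
    Σ[ u ∈ Fin n ] Σ[ w ∈ Fin n ] Σ[ u′ ∈ Fin n ] u ≢ u′ × IsEdge L u v w × IsEdge L v w u′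
  consecutive-edges t 1+t<k (inj₁ refl) = at t , at (2 + t) , at (3 + t) , ends-distinct 1+t<k ,
    edge-at (<-trans (n<1+n t) 1+t<k) , edge-at 1+t<k
  consecutive-edges t 1+t<k (inj₂ refl) = at t , at (1 + t) , at (3 + t) , ends-distinct 1+t<k ,
    IsEdge-swap₂₃ (edge-at (<-trans (n<1+n t) 1+t<k)) , IsEdge-swap₁₂ (edge-at 1+t<k)

lemma4p3 : (n : ℕ) (L : SubsetKV n) → IsIsotropicSystem n L → ThreeConnected L
    → 5 ≤ n → (k : ℕ) (P : TightPath L k) (v : Fin n) → IsInternal P v → Essential L v
lemma4p3 (suc m) L iso 3conn (s≤s 4≤m) k P v internal =
  let t , 1+t<k , v-shared = internal⇒shared-position P internal
      u , w , u′ , u≢u′ , E₁ , E₂ = consecutive-edges P t 1+t<k v-shared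
  in shared-pair-essential iso 3conn 4≤m u≢u′ E₁ E₂
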